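{- Let $n$ be a positive integer and let $g : P_d(n+1) \setminus P_c(n+1) \to P_d(n)$ be the map defined below. If $\lambda$ is an almost consecutive partition of $n$ other than the one-part partition $(n)$, then $\lambda$ has exactly one preimage under $g$.
   Context: $P_d(m)$ is the set of partitions of $m$ into distinct parts; $P_c(m) \subseteq P_d(m)$ is the subset whose parts are consecutive integers (including one-part partitions). Write $\lambda \in P_d(n+1)\setminus P_c(n+1)$ as $\lambda = (\lambda_1, \ldots, \lambda_k)$ with $\lambda_1 < \cdots < \lambda_k$; let $m$ be the largest index with $\lambda_m > \lambda_{m-1} + 1$, and define $g(\lambda) = (\lambda_1, \ldots, \lambda_{m-1}, \lambda_m - 1, \lambda_{m+1}, \ldots, \lambda_k)$. A partition $\lambda_1 < \cdots < \lambda_k$ into distinct parts is almost consecutive if $\lambda_{i+1} = \lambda_i + 1$ for all $2 \le i \le k-1$. -}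

module Defs where

open import Data.Nat using (ℕ; zero; suc; _+_; _<_; _≤_; _∸_)
open import Data.List using (List; []; _∷_)
open import Data.Nat.ListAction using (sum)
open import Data.Bool using (Bool; true; false; if_then_else_)
open import Data.Nat using (_≡ᵇ_)
open import Data.Product using (_×_)
open import Data.Empty using (⊥)
open import Data.Unit using (⊤)
open import Relation.Binary.PropositionalEquality using (_≡_)
open import Relation.Nullary using (¬_)

-- A partition is written as a list of its parts in strictly increasing order
-- λ₁ < λ₂ < ... < λ_k.

data Increasing : List ℕ → Set where
  inc-[]  : Increasing []
  inc-[x] : ∀ {x} → Increasing (x ∷ [])
  inc-∷   : ∀ {x y xs} → x < y → Increasing (y ∷ xs) → Increasing (x ∷ y ∷ xs)

data Positive : List ℕ → Set where
  pos-[] : Positive []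
  pos-∷  : ∀ {x xs} → 0 < x → Positive xs → Positive (x ∷ xs)

IsDistinctPartition : ℕ → List ℕ → Set
IsDistinctPartition m xs = Increasing xs × Positive xs × sum xs ≡ m

Consecutive : List ℕ → Set
Consecutive []           = ⊤
Consecutive (x ∷ [])     = ⊤
Consecutive (x ∷ y ∷ xs) = (y ≡ suc x) × Consecutive (y ∷ xs)

IsConsecutivePartition : ℕ → List ℕ → Set
IsConsecutivePartition m xs = IsDistinctPartition m xs × Consecutive xs

AlmostConsecutive : List ℕ → Set
AlmostConsecutive []       = ⊤
AlmostConsecutive (x ∷ xs) = Consecutive xs

hasGap : List ℕ → Bool
hasGap []           = false
hasGap (x ∷ [])     = false
hasGap (x ∷ y ∷ xs) = if y ≡ᵇ suc x then hasGap (y ∷ xs) else true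

-- the map g: decrease by one the part λ_m, where m is the largest index
-- with λ_m > λ_{m-1} + 1 (on increasing lists, "gap" means exactly this).
-- If there is no such index the list is returned unchanged (g is only
-- applied to non-consecutive partitions).
g : List ℕ → List ℕ
g []           = []
g (x ∷ [])     = x ∷ []
g (x ∷ y ∷ xs) =
  if hasGap (y ∷ xs) then x ∷ g (y ∷ xs)
  else (if y ≡ᵇ suc x then x ∷ y ∷ xs else x ∷ (y ∸ 1) ∷ xs)

InDomain : ℕ → List ℕ → Set
InDomain n μ = IsDistinctPartition (suc n) μ × ¬ IsConsecutivePartition (suc n) μ

{-# OPTIONS --safe #-}
-- Write λ = (x, a, a+1, …, a+j) with x < a.  Raising the largest part by one gives a
-- non-consecutive partition of n+1 whose last gap is at its last part, so g lowers that part
-- back.  Conversely, g ν = λ means that ν is λ with some part λ_m (m ≥ 2) raised by one and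
-- that ν is consecutive from position m on; as λ is consecutive from position 2, the raised
-- part would equal its successor unless m = k.
module Submission where

open import Defs
open import Data.Nat using (ℕ; zero; suc; _<_; _+_; _∸_; _≡ᵇ_; z≤n; s<s)
open import Data.Nat.Properties
  using (_≟_; suc-injective; 1+n≢n; <⇒≢; >⇒≢; n<1+n; m<n⇒m<1+n; ≤-<-trans; +-suc; +-identityʳ; <-irrefl)
open import Data.Nat.ListAction using (sum)
open import Data.List using (List; []; _∷_; [_]; length)
open import Data.List.Properties using (∷-injective)
open import Data.Product using (_×_; ∃-syntax; _,_; proj₂)
open import Data.Bool using (true; false; if_then_else_)
open import Data.Bool.Properties using (if-cong-then; if-eta)
open import Data.Unit using (tt)
open import Data.Empty using (⊥-elim)
open import Function using (_∘_)
open import Relation.Binary.PropositionalEquality using (_≡_; _≢_; refl; sym; trans; cong; cong₂; module ≡-Reasoning)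
open import Relation.Nullary using (¬_; Dec; yes; no; _×-dec_)
open import Relation.Nullary.Decidable using (dec-true; dec-false)

private
  variable
    m n x a : ℕ

-- `does (m ≟ n)` reduces to `m ≡ᵇ n`.
≡ᵇ-true : m ≡ n → (m ≡ᵇ n) ≡ true
≡ᵇ-true {m} {n} = dec-true (m ≟ n)

≡ᵇ-false : m ≢ n → (m ≡ᵇ n) ≡ false
≡ᵇ-false {m} {n} = dec-false (m ≟ n)

consecutive? : (l : List ℕ) → Dec (Consecutive l)
consecutive? []           = yes tt
consecutive? (x ∷ [])     = yes tt
consecutive? (x ∷ y ∷ xs) = (y ≟ suc x) ×-dec consecutive? (y ∷ xs)

hasGap-consecutive : ∀ l → Consecutive l → hasGap l ≡ false
hasGap-consecutive []           _ = refl
hasGap-consecutive (x ∷ [])     _ = refl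
hasGap-consecutive (x ∷ y ∷ xs) (y≡1+x , cons) =
  trans (cong (if_then hasGap (y ∷ xs) else true) (≡ᵇ-true y≡1+x)) (hasGap-consecutive (y ∷ xs) cons)

hasGap-¬consecutive : ∀ l → ¬ Consecutive l → hasGap l ≡ true
hasGap-¬consecutive []           ¬cons = ⊥-elim (¬cons tt)
hasGap-¬consecutive (x ∷ [])     ¬cons = ⊥-elim (¬cons tt)
-- The recursive call is a with-argument: made inside a with-branch, the termination checker rejects it.
hasGap-¬consecutive (x ∷ y ∷ xs) ¬cons with consecutive? (y ∷ xs) | hasGap-¬consecutive (y ∷ xs)
... | yes cons  | _        = cong (if_then hasGap (y ∷ xs) else true) (≡ᵇ-false (¬cons ∘ (_, cons)))
... | no ¬cons′ | tail-gap = trans (if-cong-then (y ≡ᵇ suc x) (tail-gap ¬cons′)) (if-eta (y ≡ᵇ suc x))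

g-∷-¬consecutive : ∀ x y xs → ¬ Consecutive (y ∷ xs) → g (x ∷ y ∷ xs) ≡ x ∷ g (y ∷ xs)
g-∷-¬consecutive x y xs ¬cons rewrite hasGap-¬consecutive (y ∷ xs) ¬cons = refl

g-∷-consecutive : ∀ x y xs → Consecutive (y ∷ xs) → y ≢ suc x → g (x ∷ y ∷ xs) ≡ x ∷ (y ∸ 1) ∷ xs
g-∷-consecutive x y xs cons y≢1+x rewrite hasGap-consecutive (y ∷ xs) cons | ≡ᵇ-false y≢1+x = refl

length-g : ∀ l → length (g l) ≡ length l
length-g []           = refl
length-g (x ∷ [])     = refl
length-g (x ∷ y ∷ xs) with hasGap (y ∷ xs) | y ≡ᵇ suc x | length-g (y ∷ xs)
... | true  | _     | ih = cong suc ih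
... | false | true  | _  = refl
... | false | false | _  = refl

sucLast : List ℕ → List ℕ
sucLast []           = []
sucLast (x ∷ [])     = [ suc x ]
sucLast (x ∷ y ∷ xs) = x ∷ sucLast (y ∷ xs)

Increasing-sucLast : ∀ {l} → Increasing l → Increasing (sucLast l)
Increasing-sucLast inc-[]                      = inc-[]
Increasing-sucLast inc-[x]                     = inc-[x]
Increasing-sucLast (inc-∷ x<y inc-[x])         = inc-∷ (m<n⇒m<1+n x<y) inc-[x]
Increasing-sucLast (inc-∷ x<y inc@(inc-∷ _ _)) = inc-∷ x<y (Increasing-sucLast inc)

Positive-sucLast : ∀ {l} → Positive l → Positive (sucLast l)
Positive-sucLast pos-[]                      = pos-[]
Positive-sucLast (pos-∷ 0<x pos-[])          = pos-∷ (m<n⇒m<1+n 0<x) pos-[]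
Positive-sucLast (pos-∷ 0<x pos@(pos-∷ _ _)) = pos-∷ 0<x (Positive-sucLast pos)

sum-sucLast : ∀ x xs → sum (sucLast (x ∷ xs)) ≡ suc (sum (x ∷ xs))
sum-sucLast x []       = refl
sum-sucLast x (y ∷ ys) = trans (cong (x +_) (sum-sucLast y ys)) (+-suc x (sum (y ∷ ys)))

IsDistinctPartition-sucLast : ∀ {x xs} → IsDistinctPartition n (x ∷ xs) →
                              IsDistinctPartition (suc n) (sucLast (x ∷ xs))
IsDistinctPartition-sucLast {x = x} {xs} (inc , pos , refl) =
  Increasing-sucLast inc , Positive-sucLast pos , sum-sucLast x xs

¬consecutive-∷-sucLast : ∀ cs → x < a → Consecutive (a ∷ cs) → ¬ Consecutive (x ∷ sucLast (a ∷ cs))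
¬consecutive-∷-sucLast []       x<a _               (1+a≡1+x , _) = <⇒≢ x<a (sym (suc-injective 1+a≡1+x))
¬consecutive-∷-sucLast (c ∷ cs) _   (refl , c-cons) (_ , cons)   =
  ¬consecutive-∷-sucLast cs (n<1+n _) c-cons cons

g-∷-sucLast : ∀ cs → x < a → Consecutive (a ∷ cs) → g (x ∷ sucLast (a ∷ cs)) ≡ x ∷ a ∷ cs
g-∷-sucLast {x} {a} []       x<a _ = g-∷-consecutive x (suc a) [] tt (>⇒≢ (s<s x<a))
g-∷-sucLast {x} {a} (c ∷ cs) _   (refl , c-cons) = begin
  g (x ∷ a ∷ sucLast (suc a ∷ cs))
    ≡⟨ g-∷-¬consecutive x a _ (¬consecutive-∷-sucLast cs (n<1+n a) c-cons) ⟩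
  x ∷ g (a ∷ sucLast (suc a ∷ cs))
    ≡⟨ cong (x ∷_) (g-∷-sucLast cs (n<1+n a) c-cons) ⟩
  x ∷ a ∷ suc a ∷ cs ∎
  where open ≡-Reasoning

g≢-singleton : ∀ {l} → ¬ Consecutive l → g l ≢ [ a ]
g≢-singleton {l = []}         _     ()
g≢-singleton {l = x ∷ []}     ¬cons _ = ¬cons tt
g≢-singleton {l = x ∷ y ∷ xs} _     g≡[a] with trans (sym (length-g (x ∷ y ∷ xs))) (cong length g≡[a])
... | ()

consecutive-∷-suc : ∀ {cs} → Consecutive (a ∷ cs) → Consecutive (suc a ∷ cs) → cs ≡ []
consecutive-∷-suc {cs = []}    _          _              = refl
consecutive-∷-suc {cs = _ ∷ _} (refl , _) (2+a≡1+a , _) = ⊥-elim (1+n≢n (sym 2+a≡1+a))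

∸1-∷≡⇒≡sucLast : ∀ y {ys cs} → 0 < a → Consecutive (y ∷ ys) → Consecutive (a ∷ cs) →
                 (y ∸ 1) ∷ ys ≡ a ∷ cs → y ∷ ys ≡ sucLast (a ∷ cs)
∸1-∷≡⇒≡sucLast zero    ()  _      _      refl
∸1-∷≡⇒≡sucLast (suc y) _   y-cons a-cons refl rewrite consecutive-∷-suc a-cons y-cons = refl

g-preimage≡sucLast : ∀ cs ν → x < a → Consecutive (a ∷ cs) → ¬ Consecutive ν →
                     g ν ≡ x ∷ a ∷ cs → ν ≡ x ∷ sucLast (a ∷ cs)
g-preimage≡sucLast _ (_ ∷ []) _ _ ¬cons _ = ⊥-elim (¬cons tt)
g-preimage≡sucLast {a = a} cs (z ∷ y ∷ ys) x<a a-cons ¬cons eq with consecutive? (y ∷ ys)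
... | yes tail-cons =
  let gν≡ = g-∷-consecutive z y ys tail-cons (¬cons ∘ (_, tail-cons))
      z≡x , tail≡ = ∷-injective (trans (sym gν≡) eq)
  in cong₂ _∷_ z≡x (∸1-∷≡⇒≡sucLast y (≤-<-trans z≤n x<a) tail-cons a-cons tail≡)
... | no tail-gap =
  let z≡x , g-tail≡ = ∷-injective (trans (sym (g-∷-¬consecutive z y ys tail-gap)) eq)
  in cong₂ _∷_ z≡x (tail-preimage cs a-cons g-tail≡)
  where
  tail-preimage : ∀ cs → Consecutive (a ∷ cs) → g (y ∷ ys) ≡ a ∷ cs → y ∷ ys ≡ sucLast (a ∷ cs)
  tail-preimage []       _               g-tail≡ = ⊥-elim (g≢-singleton tail-gap g-tail≡)
  tail-preimage (_ ∷ cs) (refl , c-cons) g-tail≡ =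
    g-preimage≡sucLast cs (y ∷ ys) (n<1+n a) c-cons tail-gap g-tail≡

mainTheorem9 : (n : ℕ) → 0 < n → (lam : List ℕ) → IsDistinctPartition n lam → AlmostConsecutive lam → ¬ (lam ≡ n ∷ [])
    → ∃[ μ ] ((InDomain n μ × g μ ≡ lam) × (∀ ν → InDomain n ν → g ν ≡ lam → ν ≡ μ))
mainTheorem9 n 0<n [] (_ , _ , refl) _ _ = ⊥-elim (<-irrefl refl 0<n)
mainTheorem9 n _ (x ∷ []) (_ , _ , x+0≡n) _ lam≢[n] =
  ⊥-elim (lam≢[n] (cong [_] (trans (sym (+-identityʳ x)) x+0≡n)))
mainTheorem9 n _ (x ∷ a ∷ cs) lam-part@(inc-∷ x<a _ , _) a-cons _ =
  sucLast (x ∷ a ∷ cs) , (μ-dom , g-∷-sucLast cs x<a a-cons) , unique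
  where
  μ-dom : InDomain n (sucLast (x ∷ a ∷ cs))
  μ-dom = IsDistinctPartition-sucLast lam-part , ¬consecutive-∷-sucLast cs x<a a-cons ∘ proj₂

  unique : ∀ ν → InDomain n ν → g ν ≡ x ∷ a ∷ cs → ν ≡ sucLast (x ∷ a ∷ cs)
  unique ν (ν-part , ν-¬cons) = g-preimage≡sucLast cs ν x<a a-cons (ν-¬cons ∘ (ν-part ,_))
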